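{- Let $P$ be a finite bounded poset with a TCL-labeling $\lambda$ taking values in the integers. Fix a total order $\Gamma: m_1,\dots,m_t$ on the maximal chains of $P$ that agrees with the lexicographic order on maximal chains induced by $\lambda$, and let $\lambda'$ be the CE-labeling of $P$ determined by $\Gamma$ (as described in the context). Suppose $x\lessdot u\lessdot b$ and $x\lessdot y\lessdot d$ with $u\ne y$, and let $r$ be a root of $x$. If $\lambda(r,x,u)<\lambda(r,x,y)$, then $\lambda'(r,x,u)<\lambda'(r,x,y)$. If $\lambda(r,x,u)=\lambda(r,x,y)$ and $\lambda(r\cup\{u\},u,b)<\lambda(r\cup\{y\},y,d)$, then $\lambda'(r\cup\{u\},u,b)<\lambda'(r\cup\{y\},y,d)$.
   Context: A poset is bounded if it has a unique minimum $\hat 0$ and maximum $\hat 1$. $x\lessdot y$ denotes a cover relation. A root of $x$ is a maximal chain of $[\hat 0,x]$; a rooted interval $[x,y]_r$ is an interval with a root $r$ of $x$; a rooted cover relation $(r,x,u)$ is $[x,u]_r$ with $x\lessdot u$. A CE-labeling assigns a label $\lambda(r,x,u)$ to each rooted cover relation. The label sequence of a maximal chain $x=x_0\lessdot\cdots\lessdot x_t=y$ of $[x,y]_r$ is $(\lambda(r,x_0,x_1),\lambda(r\cup\{x_1\},x_1,x_2),\dots,\lambda(r\cup\{x_1,\dots,x_{t-1}\},x_{t-1},x_t))$; a maximal chain of $P$ is a maximal chain of $[\hat0,\hat1]_{\{\hat0\}}$, and maximal chains are ordered lexicographically by label sequences (dictionary order, proper prefix first). A pair $(r,u,v)$, $(r\cup\{v\},v,w)$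 is a topological ascent if the label pair $(\lambda(r,u,v),\lambda(r\cup\{v\},v,w))$ strictly lexicographically precedes the label sequences of all other maximal chains of $[u,w]_r$, otherwise a topological descent; a maximal chain of $[x,y]_r$ is topologically ascending if all its consecutive pairs of covers are topological ascents. A TCL-labeling is a CE-labeling in which every rooted interval has a unique topologically ascending maximal chain. The CE-labeling $\lambda'$ determined by $\Gamma$: for $x\ne\hat1$ and root $r$ of $x$, list the atoms $a_1,\dots,a_s$ of $[x,\hat{1}]$ in the order in which they first appear together with $r$ in a maximal chain of $\Gamma$, and let $i_j$ be the index of the earliest chain of $\Gamma$ containing $r\cup\{a_j\}$. Set $\lambda'(r,x,a_1)=i_1$. Having labeled $x\lessdot a_1,\dots,x\lessdot a_{j-1}$: if there is $h<j$ such that $r\cup\{a_h\}$ is contained in maximal chains $m_k,m_l$ with $k<i_j<l$, set $\lambda'(r,x,a_j)=\lambda'(r,x,a_h)$ (for such an $h$); otherwise $\lambda'(r,x,a_j)=i_j$. -}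

module Defs where

open import Level using (0ℓ)
open import Data.Nat as ℕ using (ℕ; suc)
open import Data.Fin as Fin using (Fin; toℕ)
open import Data.Integer as ℤ using (ℤ)
open import Data.List using (List; []; _∷_; [_])
open import Data.List.Membership.Propositional using (_∈_)
open import Data.List.Relation.Unary.All using (All)
open import Data.List.Relation.Binary.Lex.Strict using (Lex-<)
open import Data.Product using (Σ; ∃; _×_; _,_)
open import Data.Sum using (_⊎_)
open import Data.Unit using (⊤)
open import Data.Empty using (⊥)
open import Relation.Nullary using (¬_)
open import Relation.Binary using (Rel; IsPartialOrder; Decidable)
open import Relation.Binary.PropositionalEquality using (_≡_; _≢_)

record FinBoundedPoset : Set₁ where
  field
    n      : ℕ
    _≤_    : Rel (Fin n) 0ℓ
    isPO   : IsPartialOrder _≡_ _≤_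
    _≤?_   : Decidable _≤_
    𝟘      : Fin n
    𝟙      : Fin n
    𝟘-min  : ∀ x → 𝟘 ≤ x
    𝟙-max  : ∀ x → x ≤ 𝟙

  _<_ : Rel (Fin n) 0ℓ
  x < y = x ≤ y × x ≢ y

  _⋖_ : Rel (Fin n) 0ℓ
  x ⋖ y = x < y × (∀ z → x < z → z < y → ⊥)

module _ (P : FinBoundedPoset) where
  open FinBoundedPoset P

  Elt : Set
  Elt = Fin n

  -- A root of x: a maximal chain of [0̂, x], stored in DESCENDING order
  -- (head is x, last element is 0̂).  r ∪ {u} for x ⋖ u is then  u ∷ r.
  data IsRoot : Elt → List Elt → Set where
    base : IsRoot 𝟘 [ 𝟘 ]
    ext  : ∀ {x u r} → IsRoot x r → x ⋖ u → IsRoot u (u ∷ r)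

  -- A maximal chain x = x₀ ⋖ x₁ ⋖ ⋯ ⋖ x_t = y of [x, y], stored in
  -- ASCENDING order.
  data MaxChain : Elt → Elt → List Elt → Set where
    done : ∀ {x} → MaxChain x x [ x ]
    step : ∀ {x u y c} → x ⋖ u → MaxChain u y c → MaxChain x y (x ∷ c)

  Labeling : Set → Set
  Labeling L = List Elt → Elt → Elt → L

  labSeq : {L : Set} → Labeling L → List Elt → List Elt → List L
  labSeq lab r (x₀ ∷ x₁ ∷ rest) = lab r x₀ x₁ ∷ labSeq lab (x₁ ∷ r) (x₁ ∷ rest)
  labSeq lab r _ = []

  _<lex_ : Rel (List ℤ) 0ℓ
  _<lex_ = Lex-< _≡_ ℤ._<_

  TopAscent : Labeling ℤ → List Elt → Elt → Elt → Elt → Set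
  TopAscent lab r u v w =
    ∀ c → MaxChain u w c → c ≢ (u ∷ v ∷ w ∷ []) →
      labSeq lab r (u ∷ v ∷ w ∷ []) <lex labSeq lab r c

  TopAscending : Labeling ℤ → List Elt → List Elt → Set
  TopAscending lab r (a ∷ b ∷ d ∷ rest) =
    TopAscent lab r a b d × TopAscending lab (b ∷ r) (b ∷ d ∷ rest)
  TopAscending lab r _ = ⊤

  IsTCL : Labeling ℤ → Set
  IsTCL lab =
    ∀ x y r → IsRoot x r → x ≤ y →
      Σ (List Elt) λ c → (MaxChain x y c × TopAscending lab r c) ×
        (∀ c' → MaxChain x y c' → TopAscending lab r c' → c' ≡ c)

  -- A total order Γ : m₁,…,m_t (here indexed by Fin t, position i ↦ m_{i+1})
  -- on the maximal chains of P agreeing with the lexicographic order of λ.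
  record ChainOrder (lab : Labeling ℤ) : Set where
    field
      t        : ℕ
      Γ        : Fin t → List Elt
      maximal  : ∀ i → MaxChain 𝟘 𝟙 (Γ i)
      injective : ∀ i j → Γ i ≡ Γ j → i ≡ j
      complete : ∀ c → MaxChain 𝟘 𝟙 c → Σ (Fin t) λ i → Γ i ≡ c
      agrees   : ∀ i j →
        labSeq lab [ 𝟘 ] (Γ i) <lex labSeq lab [ 𝟘 ] (Γ j) → i Fin.< j

  module _ {lab : Labeling ℤ} (G : ChainOrder lab) where
    open ChainOrder G

    ContainedIn : List Elt → Fin t → Set
    ContainedIn s k = All (λ z → z ∈ Γ k) s

    Earliest : List Elt → Elt → Fin t → Set
    Earliest r a i = ContainedIn (a ∷ r) i × (∀ k → k Fin.< i → ¬ ContainedIn (a ∷ r) k)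

    Straddles : List Elt → Elt → Fin t → Set
    Straddles r a' i = Σ (Fin t) λ k → Σ (Fin t) λ l →
      k Fin.< i × i Fin.< l × ContainedIn (a' ∷ r) k × ContainedIn (a' ∷ r) l

    -- λ' is the CE-labeling determined by Γ (labels are 1-based indices).
    -- Atoms a of [x,1̂] are ordered by their earliest index; a_h precedes a_j
    -- iff the earliest index of a_h is smaller than that of a_j.
    IsDeterminedBy : Labeling ℕ → Set
    IsDeterminedBy lab' =
      ∀ x r a i → IsRoot x r → x ⋖ a → Earliest r a i →
        (Σ Elt λ a' → Σ (Fin t) λ i' →
           x ⋖ a' × Earliest r a' i' × i' Fin.< i × Straddles r a' i ×
           lab' r x a ≡ lab' r x a')
        ⊎
        ((∀ a' i' → x ⋖ a' → Earliest r a' i' → i' Fin.< i → ¬ Straddles r a' i) ×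
         lab' r x a ≡ suc (toℕ i))

-- Every maximal chain of P containing r ∪ {a} (r a root of x, x ⋖ a) passes
-- through r in order, so its label sequence begins with the labels of r
-- followed by λ(r,x,a).  As Γ refines the lexicographic order, λ(r,x,a) <
-- λ(r',x',b) for roots with equal label sequences forces every chain through
-- r ∪ {a} to come before every chain through r' ∪ {b}.  Now λ'(r,x,a) is at
-- most 1 + the earliest index of a.  If b receives its own earliest index as
-- label we are done; otherwise b inherits the label of an atom b' whose chains
-- straddle that index, which is only possible if λ(r',x',b') = λ(r',x',b),
-- and we conclude by induction on the earliest index.
module Submission where

open import Defs
open import Data.Nat as ℕ using (ℕ; suc; s≤s)
open import Data.Integer as ℤ using (ℤ)
open import Data.List using (List; _∷_; []; [_]; _++_)
open import Data.List.Properties using (++-assoc)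
open import Data.Fin using (Fin; toℕ)
import Data.Fin as Fin
import Data.Fin.Properties as FinP
import Data.Fin.Induction as FinI
import Data.Nat.Properties as ℕP
import Data.Integer.Properties as ℤP
open import Relation.Binary.PropositionalEquality
  using (_≡_; _≢_; refl; sym; trans; cong; subst; subst₂; module ≡-Reasoning)
open import Data.Product using (_×_; ∃; _,_; proj₁; proj₂)
open import Data.Sum using (_⊎_; inj₁; inj₂)
open import Data.Empty using (⊥-elim)
open import Relation.Nullary using (¬_; yes; no)
open import Relation.Nullary.Decidable using (_×-dec_)
import Relation.Unary as U
open import Relation.Binary using (Decidable; IsPartialOrder; tri<; tri≈; tri>)
import Relation.Binary.Construct.NonStrictToStrict as ToStrict
open import Induction.WellFounded using (Acc; acc)
open import Data.List.Membership.Propositional using (_∈_)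
open import Data.List.Relation.Unary.Any using (here; there)
open import Data.List.Relation.Unary.All as All using (All; _∷_)
open import Data.List.Relation.Binary.Subset.Propositional using (_⊆_)
import Data.List.Membership.DecPropositional as DecMembership
open import Data.List.Relation.Binary.Lex.Core using (this; next)

∃-least : ∀ {m p} {Q : U.Pred (Fin m) p} → U.Decidable Q → ∀ {k} → Q k →
          ∃ λ i → Q i × (∀ j → j Fin.< i → ¬ Q j)
∃-least {Q = Q} Q? {k} = go k (FinI.<-wellFounded k)
  where
  go : ∀ k → Acc Fin._<_ k → Q k → ∃ λ i → Q i × (∀ j → j Fin.< i → ¬ Q j)
  go k (acc rs) qk with FinP.any? (λ j → (j Fin.<? k) ×-dec Q? j)
  ... | yes (j , j<k , qj) = go j (rs j<k) qj
  ... | no none = k , qk , λ j j<k qj → none (j , j<k , qj)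

++-<lex : ∀ (P : FinBoundedPoset) {C C′ p q} X Y → C ≡ C′ → p ℤ.< q →
          _<lex_ P (C ++ p ∷ X) (C′ ++ q ∷ Y)
++-<lex P {[]}    X Y refl p<q = this p<q
++-<lex P {c ∷ C} X Y refl p<q = next refl (++-<lex P X Y refl p<q)

module _ (P : FinBoundedPoset) where
  open FinBoundedPoset P
  private
    module PO = IsPartialOrder isPO

  <-trans : ∀ {x y z} → x < y → y < z → x < z
  <-trans = ToStrict.<-trans _≡_ _≤_ isPO

  <-asym : ∀ {x y} → x < y → ¬ y < x
  <-asym = ToStrict.<-asym _≡_ _≤_ PO.antisym

  _<?_ : Decidable _<_
  _<?_ = ToStrict.<-decidable _≡_ _≤_ FinP._≟_ _≤?_

  head∈ : ∀ {x y c} → MaxChain P x y c → x ∈ c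
  head∈ done       = here refl
  head∈ (step _ _) = here refl

  head≤ : ∀ {x y c z} → MaxChain P x y c → z ∈ c → x ≤ z
  head≤ done           (here refl) = PO.refl
  head≤ (step _ _)     (here refl) = PO.refl
  head≤ (step x⋖u mc) (there z∈c) = PO.trans (proj₁ (proj₁ x⋖u)) (head≤ mc z∈c)

  MaxChain-through-⋖ : ∀ {x u y c} → x ⋖ u → MaxChain P x y c → u ∈ c →
                       ∃ λ c′ → c ≡ x ∷ c′ × MaxChain P u y c′
  MaxChain-through-⋖ (x<u , _) done (here refl) = ⊥-elim (proj₂ x<u refl)
  MaxChain-through-⋖ (x<u , _) (step _ _) (here refl) = ⊥-elim (proj₂ x<u refl)
  MaxChain-through-⋖ {u = u} (_ , x⋖) (step {u = v} x⋖v mc) (there u∈c)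
    with v FinP.≟ u
  ... | yes refl = _ , refl , mc
  ... | no v≢u   = ⊥-elim (x⋖ v (proj₁ x⋖v) (head≤ mc u∈c , v≢u))

  <⇒∃⋖ : ∀ {a z} → a < z → ∃ (a ⋖_)
  <⇒∃⋖ {a} {z} = go z (FinI.po-wellFounded isPO z)
    where
    go : ∀ z → Acc _<_ z → a < z → ∃ (a ⋖_)
    go z (acc rs) a<z with FinP.any? (λ w → (a <? w) ×-dec (w <? z))
    ... | yes (w , a<w , w<z) = go w (rs w<z) a<w
    ... | no none = z , a<z , λ w a<w w<z → none (w , a<w , w<z)

  ∃-MaxChain-to-𝟙 : ∀ a → ∃ (MaxChain P a 𝟙)
  ∃-MaxChain-to-𝟙 a = go a (FinI.po-noetherian isPO a)
    where
    go : ∀ a → Acc (λ p q → q < p) a → ∃ (MaxChain P a 𝟙)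
    go a (acc rs) with a FinP.≟ 𝟙
    ... | yes refl = _ , done
    ... | no a≢𝟙 with <⇒∃⋖ (𝟙-max a , a≢𝟙)
    ...   | c , a⋖c with go c (rs (proj₁ a⋖c))
    ...     | _ , mc = _ , step a⋖c mc

  root-++-MaxChain : ∀ {x ρ c} → IsRoot P x ρ → MaxChain P x 𝟙 c →
                     ∃ λ c₀ → MaxChain P 𝟘 𝟙 c₀ × All (_∈ c₀) ρ × c ⊆ c₀
  root-++-MaxChain base mc = _ , mc , head∈ mc ∷ All.[] , λ z∈c → z∈c
  root-++-MaxChain (ext R x⋖u) mc with root-++-MaxChain R (step x⋖u mc)
  ... | c₀ , mc₀ , ρ⊆c₀ , c⊆c₀ =
    c₀ , mc₀ , c⊆c₀ (there (head∈ mc)) ∷ ρ⊆c₀ , λ z∈c → c⊆c₀ (there z∈c)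

  ∃-MaxChain-⊇-root : ∀ {x ρ} → IsRoot P x ρ →
                      ∃ λ c₀ → MaxChain P 𝟘 𝟙 c₀ × All (_∈ c₀) ρ
  ∃-MaxChain-⊇-root {x} R with root-++-MaxChain R (proj₂ (∃-MaxChain-to-𝟙 x))
  ... | c₀ , mc₀ , ρ⊆c₀ , _ = c₀ , mc₀ , ρ⊆c₀

  module _ (lab : Labeling P ℤ) where

    rootLabels : ∀ {x ρ} → IsRoot P x ρ → List ℤ
    rootLabels base                     = []
    rootLabels (ext {x} {u} {r} R _) = rootLabels R ++ [ lab r x u ]

    labSeq-step : ∀ {x u y c} r → MaxChain P u y c →
                  labSeq P lab r (x ∷ c) ≡ lab r x u ∷ labSeq P lab (u ∷ r) c
    labSeq-step r done       = refl
    labSeq-step r (step _ _) = refl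

    -- The invariant "every element of c lies below x or on c′" is what lets
    -- the induction locate the next element of the root on c′.
    labSeq-split-at-root : ∀ {x ρ c} (R : IsRoot P x ρ) → MaxChain P 𝟘 𝟙 c →
      All (_∈ c) ρ →
      ∃ λ c′ → MaxChain P x 𝟙 c′ × (∀ {z} → z ∈ c → z < x ⊎ z ∈ c′) ×
               labSeq P lab [ 𝟘 ] c ≡ rootLabels R ++ labSeq P lab ρ c′
    labSeq-split-at-root base mc _ = _ , mc , inj₂ , refl
    labSeq-split-at-root {c = c} (ext {x} {u} {r} R x⋖u) mc (u∈c ∷ ρ⊆c)
      with labSeq-split-at-root R mc ρ⊆c
    ... | c′ , mc′ , c⊆ , eq with c⊆ u∈c
    ...   | inj₁ u<x = ⊥-elim (<-asym u<x (proj₁ x⋖u))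
    ...   | inj₂ u∈c′ with MaxChain-through-⋖ x⋖u mc′ u∈c′
    ...     | c″ , refl , mc″ = c″ , mc″ , c⊆′ , eq′
      where
      c⊆′ : ∀ {z} → z ∈ c → z < u ⊎ z ∈ c″
      c⊆′ z∈c with c⊆ z∈c
      ... | inj₁ z<x          = inj₁ (<-trans z<x (proj₁ x⋖u))
      ... | inj₂ (here refl)  = inj₁ (proj₁ x⋖u)
      ... | inj₂ (there z∈c″) = inj₂ z∈c″

      open ≡-Reasoning
      eq′ : labSeq P lab [ 𝟘 ] c ≡ rootLabels (ext R x⋖u) ++ labSeq P lab (u ∷ r) c″
      eq′ = begin
        labSeq P lab [ 𝟘 ] c
          ≡⟨ eq ⟩
        rootLabels R ++ labSeq P lab r (x ∷ c″)
          ≡⟨ cong (rootLabels R ++_) (labSeq-step r mc″) ⟩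
        rootLabels R ++ lab r x u ∷ labSeq P lab (u ∷ r) c″
          ≡⟨ sym (++-assoc (rootLabels R) [ lab r x u ] _) ⟩
        (rootLabels R ++ [ lab r x u ]) ++ labSeq P lab (u ∷ r) c″ ∎

    labSeq-through : ∀ {x ρ a c} (R : IsRoot P x ρ) → x ⋖ a → MaxChain P 𝟘 𝟙 c →
      All (_∈ c) (a ∷ ρ) →
      ∃ λ T → labSeq P lab [ 𝟘 ] c ≡ rootLabels R ++ lab ρ x a ∷ T
    labSeq-through {ρ = ρ} {a} R x⋖a mc a∷ρ⊆c
      with labSeq-split-at-root (ext R x⋖a) mc a∷ρ⊆c
    ... | c′ , _ , _ , eq =
      _ , trans eq (++-assoc (rootLabels R) [ lab ρ _ a ] (labSeq P lab (a ∷ ρ) c′))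

    module _ (G : ChainOrder P lab) where
      open ChainOrder G
      open DecMembership (FinP._≟_ {n}) using (_∈?_)

      ∃-Earliest : ∀ {x ρ a} → IsRoot P x ρ → x ⋖ a → ∃ (Earliest P G ρ a)
      ∃-Earliest R x⋖a with ∃-MaxChain-⊇-root (ext R x⋖a)
      ... | c₀ , mc₀ , ⊆c₀ with complete c₀ mc₀
      ...   | k , refl =
        ∃-least (λ i → All.all? (_∈? Γ i) _) ⊆c₀

      chain-index-< : ∀ {x₁ ρ₁ a x₂ ρ₂ b k l}
        (R₁ : IsRoot P x₁ ρ₁) (R₂ : IsRoot P x₂ ρ₂) → x₁ ⋖ a → x₂ ⋖ b →
        rootLabels R₁ ≡ rootLabels R₂ → lab ρ₁ x₁ a ℤ.< lab ρ₂ x₂ b →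
        ContainedIn P G (a ∷ ρ₁) k → ContainedIn P G (b ∷ ρ₂) l → k Fin.< l
      chain-index-< {k = k} {l} R₁ R₂ x₁⋖a x₂⋖b same p<q ∈k ∈l
        with labSeq-through R₁ x₁⋖a (maximal k) ∈k
           | labSeq-through R₂ x₂⋖b (maximal l) ∈l
      ... | T₁ , eq₁ | T₂ , eq₂ =
        agrees k l (subst₂ (_<lex_ P) (sym eq₁) (sym eq₂) (++-<lex P T₁ T₂ same p<q))

      straddling-same-label : ∀ {x ρ b b′ i} (R : IsRoot P x ρ) → x ⋖ b → x ⋖ b′ →
        Earliest P G ρ b i → Straddles P G ρ b′ i → lab ρ x b′ ≡ lab ρ x b
      straddling-same-label {x = x} {ρ} {b} {b′} R x⋖b x⋖b′ (∈i , _)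
                            (k , l , k<i , i<l , ∈k , ∈l)
        with ℤP.<-cmp (lab ρ x b′) (lab ρ x b)
      ... | tri< b′<b _ _ = ⊥-elim (FinP.<-asym i<l (chain-index-< R R x⋖b′ x⋖b refl b′<b ∈l ∈i))
      ... | tri≈ _ b′≡b _ = b′≡b
      ... | tri> _ _ b<b′ = ⊥-elim (FinP.<-asym k<i (chain-index-< R R x⋖b x⋖b′ refl b<b′ ∈i ∈k))

      module _ {lab′ : Labeling P ℕ} (det : IsDeterminedBy P G lab′) where

        lab′-≤-earliest : ∀ {x ρ a i} → IsRoot P x ρ → x ⋖ a → Earliest P G ρ a i →
                          lab′ ρ x a ℕ.≤ suc (toℕ i)
        lab′-≤-earliest {x} {ρ} {a} {i} R = go i (FinI.<-wellFounded i) a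
          where
          go : ∀ i → Acc Fin._<_ i → ∀ a → x ⋖ a → Earliest P G ρ a i →
               lab′ ρ x a ℕ.≤ suc (toℕ i)
          go i (acc rs) a x⋖a e with det x ρ a i R x⋖a e
          ... | inj₂ (_ , a↦i) = ℕP.≤-reflexive a↦i
          ... | inj₁ (a′ , i′ , x⋖a′ , e′ , i′<i , _ , a↦a′) = begin
            lab′ ρ x a   ≡⟨ a↦a′ ⟩
            lab′ ρ x a′  ≤⟨ go i′ (rs i′<i) a′ x⋖a′ e′ ⟩
            suc (toℕ i′) ≤⟨ s≤s (ℕP.<⇒≤ i′<i) ⟩
            suc (toℕ i)  ∎
            where open ℕP.≤-Reasoning

        lab′-<-of-lab-< : ∀ {x₁ ρ₁ a x₂ ρ₂ b}
          (R₁ : IsRoot P x₁ ρ₁) (R₂ : IsRoot P x₂ ρ₂) → x₁ ⋖ a → x₂ ⋖ b →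
          rootLabels R₁ ≡ rootLabels R₂ → lab ρ₁ x₁ a ℤ.< lab ρ₂ x₂ b →
          lab′ ρ₁ x₁ a ℕ.< lab′ ρ₂ x₂ b
        lab′-<-of-lab-< {x₁} {ρ₁} {a} {x₂} {ρ₂} {b} R₁ R₂ x₁⋖a x₂⋖b same
          with ∃-Earliest R₁ x₁⋖a | ∃-Earliest R₂ x₂⋖b
        ... | iA , eA | iB , eB = go iB (FinI.<-wellFounded iB) b x₂⋖b eB
          where
          go : ∀ i → Acc Fin._<_ i → ∀ b → x₂ ⋖ b → Earliest P G ρ₂ b i →
               lab ρ₁ x₁ a ℤ.< lab ρ₂ x₂ b → lab′ ρ₁ x₁ a ℕ.< lab′ ρ₂ x₂ b
          go i (acc rs) b x₂⋖b e a<b with det x₂ ρ₂ b i R₂ x₂⋖b e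
          ... | inj₂ (_ , b↦i) = begin-strict
            lab′ ρ₁ x₁ a ≤⟨ lab′-≤-earliest R₁ x₁⋖a eA ⟩
            suc (toℕ iA) <⟨ s≤s (chain-index-< R₁ R₂ x₁⋖a x₂⋖b same a<b (proj₁ eA) (proj₁ e)) ⟩
            suc (toℕ i)  ≡⟨ sym b↦i ⟩
            lab′ ρ₂ x₂ b ∎
            where open ℕP.≤-Reasoning
          ... | inj₁ (b′ , i′ , x₂⋖b′ , e′ , i′<i , straddle , b↦b′) =
            subst (lab′ ρ₁ x₁ a ℕ.<_) (sym b↦b′)
              (go i′ (rs i′<i) b′ x₂⋖b′ e′
                (subst (lab ρ₁ x₁ a ℤ.<_)
                  (sym (straddling-same-label R₂ x₂⋖b x₂⋖b′ e straddle)) a<b))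

proposition4p7 : (P : FinBoundedPoset) →
    let open FinBoundedPoset P in
    (lab : Labeling P ℤ) → IsTCL P lab →
    (G : ChainOrder P lab) →
    (lab' : Labeling P ℕ) → IsDeterminedBy P G lab' →
    (x u b y d : Fin n) (r : List (Fin n)) →
    x ⋖ u → u ⋖ b → x ⋖ y → y ⋖ d → u ≢ y → IsRoot P x r →
    (lab r x u ℤ.< lab r x y → lab' r x u ℕ.< lab' r x y)
    ×
    (lab r x u ≡ lab r x y → lab (u ∷ r) u b ℤ.< lab (y ∷ r) y d →
    lab' (u ∷ r) u b ℕ.< lab' (y ∷ r) y d)
proposition4p7 P lab _ G lab' det x u b y d r x⋖u u⋖b x⋖y y⋖d _ R =
  lab′-<-of-lab-< P lab G det R R x⋖u x⋖y refl ,
  λ xu≡xy → lab′-<-of-lab-< P lab G det (ext R x⋖u) (ext R x⋖y) u⋖b y⋖d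
              (cong (λ l → rootLabels P lab R ++ [ l ]) xu≡xy)
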